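{- Let $0<p<1$ be a probability, $n,m$ positive integers, and $Y\sim\mathrm{Bin}(n,p)$. Let $\ell,u$ be integers with $0\le\ell\le u\le n$ and define $\mathbf p=\max_{\ell\le i\le u}\{p^i(1-p)^{n-i}\}$. Then $$\mathbf p=\begin{cases}p^\ell(1-p)^{n-\ell},&\text{if }p<1/2;\\ 1/2^n,&\text{if }p=1/2;\\ p^u(1-p)^{n-u},&\text{otherwise.}\end{cases}$$ Moreover, the expected number of distinct sets in $\mathcal B_{n,m,p}$ with cardinality between $\ell$ and $u$ (inclusive), denoted $\|\mathcal B_{n,m,p}(\ell,u)\|$, satisfies $$\frac{m}{1+m\mathbf p}\cdot\Pr[\ell\le Y\le u]\le\mathbb E[\|\mathcal B_{n,m,p}(\ell,u)\|]\le m\cdot\Pr[\ell\le Y\le u].$$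
   Context: The random multi-hypergraph $\mathcal B_{n,m,p}$ on vertex set $[n]$ is the multiset of $m$ independently sampled subsets of $[n]$, each containing every vertex independently with probability $p$. $\|\mathcal B_{n,m,p}(\ell,u)\|$ is the number of distinct subsets $S\subseteq[n]$ with $\ell\le|S|\le u$ that occur at least once among the $m$ samples.
   Formalization: The probability p, with $0<p<1$, is taken to be rational. -}

module Defs where

open import Data.Bool using (Bool; true; false; if_then_else_)
open import Data.Nat as ℕ using (ℕ; zero; suc; _∸_; _≤?_)
open import Data.Nat.Combinatorics using (_C_)
open import Data.Integer using (+_)
open import Data.Rational using (ℚ; 0ℚ; 1ℚ; _+_; _*_; _-_; _⊔_; _/_)
open import Data.Fin using (Fin)
open import Data.Fin.Subset using (Subset; ∣_∣; _∈_)
open import Data.Vec.Properties using (≡-dec)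
import Data.Bool as Bool
open import Data.Vec using (Vec; []; _∷_; toList; foldr)
open import Data.List as List using (List; []; _∷_; map; concatMap; filter; length; upTo)
open import Data.List.Membership.Propositional.Properties using ()
open import Data.List.Relation.Unary.Any using (any?)
open import Relation.Binary.PropositionalEquality using (_≡_)
open import Relation.Nullary.Decidable using (_×-dec_)
open import Data.Product using (_×_)

ℕ→ℚ : ℕ → ℚ
ℕ→ℚ k = + k / 1

_^ℚ_ : ℚ → ℕ → ℚ
x ^ℚ zero = 1ℚ
x ^ℚ suc k = x * (x ^ℚ k)

sumℚ : List ℚ → ℚ
sumℚ = List.foldr _+_ 0ℚ

range : ℕ → ℕ → List ℕ
range ℓ u = List.map (ℓ ℕ.+_) (upTo (suc u ∸ ℓ))

allSubsets : (n : ℕ) → List (Subset n)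
allSubsets zero = [] ∷ []
allSubsets (suc n) = map (true ∷_) (allSubsets n) List.++ map (false ∷_) (allSubsets n)

-- all length-m sequences of subsets of [n]: the outcomes of the m samples
allSamples : (n m : ℕ) → List (Vec (Subset n) m)
allSamples n zero = [] ∷ []
allSamples n (suc m) = concatMap (λ S → map (S ∷_) (allSamples n m)) (allSubsets n)

-- probability that one random subset (each vertex independently with prob. p) equals S
setProb : ℚ → ∀ {n} → Subset n → ℚ
setProb p [] = 1ℚ
setProb p (true ∷ S) = p * setProb p S
setProb p (false ∷ S) = (1ℚ - p) * setProb p S

sampleProb : ℚ → ∀ {n m} → Vec (Subset n) m → ℚ
sampleProb p [] = 1ℚ
sampleProb p (S ∷ ω) = setProb p S * sampleProb p ω

-- ‖B(ℓ,u)‖ for a given outcome: number of distinct subsets S with ℓ ≤ |S| ≤ u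
-- occurring at least once among the samples
distinctInRange : ∀ {n m} → ℕ → ℕ → Vec (Subset n) m → ℕ
distinctInRange {n} ℓ u ω =
  length (filter (λ S → ((ℓ ≤? ∣ S ∣) ×-dec (∣ S ∣ ≤? u)) ×-dec any? (λ T → ≡-dec Bool._≟_ S T) (toList ω))
                 (allSubsets n))

expectedDistinct : ℚ → (n m ℓ u : ℕ) → ℚ
expectedDistinct p n m ℓ u =
  sumℚ (map (λ ω → sampleProb p ω * ℕ→ℚ (distinctInRange ℓ u ω)) (allSamples n m))

pointProb : ℚ → ℕ → ℕ → ℚ
pointProb p n i = (p ^ℚ i) * ((1ℚ - p) ^ℚ (n ∸ i))

binProbRange : ℚ → (n ℓ u : ℕ) → ℚ
binProbRange p n ℓ u = sumℚ (map (λ i → ℕ→ℚ (n C i) * pointProb p n i) (range ℓ u))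

-- bold p = max_{ℓ ≤ i ≤ u} p^i (1-p)^(n-i)   (for ℓ ≤ u; the i = ℓ term is always included)
boldP : ℚ → (n ℓ u : ℕ) → ℚ
boldP p n ℓ u = List.foldr _⊔_ (pointProb p n ℓ) (map (pointProb p n) (range ℓ u))

{-# OPTIONS --safe #-}
-- Write q_S = p^|S| (1-p)^(n-|S|) for the probability that one sample equals S. Both sides of
-- the expectation bound are sums over the sets S with ℓ ≤ |S| ≤ u: Pr[ℓ ≤ Y ≤ u] = Σ q_S, and
-- E‖B(ℓ,u)‖ = Σ Pr[S occurs] = Σ (1 - (1-q_S)^m) by linearity of expectation and independence
-- of the m samples. Termwise, 1 - (1-q)^m ≤ m q is the union bound, while (1-q)^m (1 + m q) ≤ 1
-- gives m q ≤ (1 + m q)(1 - (1-q)^m) ≤ (1 + m 𝐩)(1 - (1-q)^m) because q_S ≤ 𝐩.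
-- The formula for 𝐩 holds because consecutive terms p^(i+1) (1-p)^(n-i-1) and p^i (1-p)^(n-i)
-- are p w and (1-p) w for the same w ≥ 0, so i ↦ p^i (1-p)^(n-i) is monotone on [0, n],
-- non-increasing exactly when p ≤ 1 - p.
module Submission where

open import Defs
open import Data.Nat using (ℕ; _≤_)
open import Data.Rational using (ℚ; 0ℚ; 1ℚ; ½; _+_; _*_)
open import Data.Rational as Q using ()
open import Data.Rational using (_-_; _⊔_)
open import Data.Product using (_×_)
open import Relation.Binary.PropositionalEquality using (_≡_)

open import Data.Bool using (Bool; true; false) renaming (_≟_ to _≟ᵇ_)
open import Data.Fin.Subset using (Subset; ∣_∣)
open import Data.Fin.Subset.Properties using (∣p∣≤n)
import Data.Integer as ℤ
import Data.Integer.Properties as ℤP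
open import Data.List using (List; []; _∷_; map; concatMap; filter; length; _++_)
open import Data.List.Membership.Propositional using (_∈_; _∉_)
open import Data.List.Membership.Propositional.Properties
  using (∈-map⁺; ∈-map⁻; ∈-upTo⁺; ∈-upTo⁻; ∈-++⁺ˡ; ∈-++⁺ʳ)
open import Data.List.Properties using (foldr-preservesᵇ; foldr-preservesᵒ; map-cong; map-∘)
import Data.List.Relation.Unary.All as All
import Data.List.Relation.Unary.All.Properties as All
open import Data.List.Relation.Unary.AllPairs using ([]; _∷_)
open import Data.List.Relation.Binary.Disjoint.Propositional using (Disjoint)
import Data.List.Relation.Unary.Any as Any
import Data.List.Relation.Unary.Any.Properties as Any
open import Data.List.Relation.Unary.Unique.Propositional using (Unique)
import Data.List.Relation.Unary.Unique.Propositional.Properties as Unique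
open import Data.Nat as ℕ using (zero; suc; _≤?_; _≤′_; ≤′-refl; ≤′-step)
import Data.Nat.Properties as ℕP
open import Data.Nat.Combinatorics using (_C_; nCk+nC[k+1]≡[n+1]C[k+1])
open import Data.Nat.Coprimality using (1-coprimeTo)
import Data.Nat.Coprimality as Coprime
open import Data.Product using (_,_; ∃-syntax)
import Data.Rational.Properties as QP
open import Data.Sum using (_⊎_; inj₁; inj₂)
open import Data.Vec using (Vec; []; _∷_; toList; head; tail)
open import Data.Vec.Properties using (≡-dec; ∷-injectiveʳ)
open import Function using (_∘_; flip)
open import Level using (0ℓ)
open import Relation.Binary using (Rel; Reflexive; Transitive; DecidableEquality)
open import Relation.Binary.PropositionalEquality
  using (refl; sym; trans; cong; cong₂; subst; subst₂; module ≡-Reasoning)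
open import Relation.Nullary using (Dec; yes; no; does; ¬_)
open import Relation.Nullary.Decidable using (_×-dec_; _⊎-dec_; dec-true; dec-false; dec⇒maybe)
open import Tactic.RingSolver using (solve-∀)
open import Tactic.RingSolver.Core.AlmostCommutativeRing using (AlmostCommutativeRing; fromCommutativeRing)

private
  variable
    A B P P′ : Set

ℚ-ring : AlmostCommutativeRing 0ℓ 0ℓ
ℚ-ring = fromCommutativeRing QP.+-*-commutativeRing (λ x → dec⇒maybe (0ℚ QP.≟ x))

ℕ→ℚ-+ : ∀ a b → ℕ→ℚ (a ℕ.+ b) ≡ ℕ→ℚ a + ℕ→ℚ b
ℕ→ℚ-+ a b = sym (trans (cong₂ _+_ (ℕ→ℚ≡mkℚ a) (ℕ→ℚ≡mkℚ b))
  (cong (Q._/ 1) (cong₂ ℤ._+_ (ℤP.*-identityʳ (ℤ.+ a)) (ℤP.*-identityʳ (ℤ.+ b)))))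
  where
  ℕ→ℚ≡mkℚ : ∀ k → ℕ→ℚ k ≡ Q.mkℚ (ℤ.+ k) 0 (Coprime.sym (1-coprimeTo k))
  ℕ→ℚ≡mkℚ k = QP.normalize-coprime _

ℕ→ℚ-suc : ∀ m → ℕ→ℚ (suc m) ≡ 1ℚ + ℕ→ℚ m
ℕ→ℚ-suc = ℕ→ℚ-+ 1

0≤ℕ→ℚ : ∀ m → 0ℚ Q.≤ ℕ→ℚ m
0≤ℕ→ℚ m = QP.nonNegative⁻¹ (ℕ→ℚ m) {{QP.normalize-nonNeg m 1}}

0≤q-p : ∀ {p q} → p Q.≤ q → 0ℚ Q.≤ q - p
0≤q-p {p} {q} p≤q = subst₂ Q._≤_ (QP.+-inverseʳ p) refl (QP.+-monoˡ-≤ (Q.- p) p≤q)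

p≤p+q : ∀ {p q} → 0ℚ Q.≤ q → p Q.≤ p + q
p≤p+q {p} {q} 0≤q = subst₂ Q._≤_ (QP.+-identityʳ p) refl (QP.+-monoʳ-≤ p 0≤q)

0≤p*q : ∀ {p q} → 0ℚ Q.≤ p → 0ℚ Q.≤ q → 0ℚ Q.≤ p * q
0≤p*q {p} {q} 0≤p 0≤q =
  QP.nonNegative⁻¹ (p * q) {{QP.nonNeg*nonNeg⇒nonNeg p {{Q.nonNegative 0≤p}} q {{Q.nonNegative 0≤q}}}}

*-monoˡ-≤-0≤ : ∀ {r p q} → 0ℚ Q.≤ r → p Q.≤ q → r * p Q.≤ r * q
*-monoˡ-≤-0≤ {r} 0≤r = QP.*-monoˡ-≤-nonNeg r {{Q.nonNegative 0≤r}}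

*-monoʳ-≤-0≤ : ∀ {r p q} → 0ℚ Q.≤ r → p Q.≤ q → p * r Q.≤ q * r
*-monoʳ-≤-0≤ {r} 0≤r = QP.*-monoʳ-≤-nonNeg r {{Q.nonNegative 0≤r}}

1-q≤1 : ∀ {q} → 0ℚ Q.≤ q → 1ℚ - q Q.≤ 1ℚ
1-q≤1 {q} 0≤q = begin
  1ℚ - q        ≤⟨ p≤p+q 0≤q ⟩
  1ℚ - q + q    ≡⟨ cancel q ⟩
  1ℚ            ∎
  where
  open QP.≤-Reasoning
  cancel : ∀ q → 1ℚ - q + q ≡ 1ℚ
  cancel = solve-∀ ℚ-ring

*-≤1 : ∀ {p q} → 0ℚ Q.≤ p → p Q.≤ 1ℚ → q Q.≤ 1ℚ → p * q Q.≤ 1ℚ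
*-≤1 {p} {q} 0≤p p≤1 q≤1 = begin
  p * q   ≤⟨ *-monoˡ-≤-0≤ 0≤p q≤1 ⟩
  p * 1ℚ  ≡⟨ QP.*-identityʳ p ⟩
  p       ≤⟨ p≤1 ⟩
  1ℚ      ∎
  where open QP.≤-Reasoning

p≤½⇒p≤1-p : ∀ {p} → p Q.≤ ½ → p Q.≤ 1ℚ - p
p≤½⇒p≤1-p {p} p≤½ = begin
  p                           ≤⟨ p≤p+q (QP.+-mono-≤ (0≤q-p p≤½) (0≤q-p p≤½)) ⟩
  p + ((½ - p) + (½ - p))     ≡⟨ simplify p ⟩
  1ℚ - p                      ∎
  where
  open QP.≤-Reasoning
  simplify : ∀ p → p + ((½ - p) + (½ - p)) ≡ 1ℚ - p
  simplify = solve-∀ ℚ-ring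

½≤p⇒1-p≤p : ∀ {p} → ½ Q.≤ p → 1ℚ - p Q.≤ p
½≤p⇒1-p≤p {p} ½≤p = begin
  1ℚ - p                          ≤⟨ p≤p+q (QP.+-mono-≤ (0≤q-p ½≤p) (0≤q-p ½≤p)) ⟩
  1ℚ - p + ((p - ½) + (p - ½))    ≡⟨ simplify p ⟩
  p                               ∎
  where
  open QP.≤-Reasoning
  simplify : ∀ p → 1ℚ - p + ((p - ½) + (p - ½)) ≡ p
  simplify = solve-∀ ℚ-ring

^ℚ-+ : ∀ x a b → x ^ℚ (a ℕ.+ b) ≡ x ^ℚ a * x ^ℚ b
^ℚ-+ x zero b = sym (QP.*-identityˡ _)
^ℚ-+ x (suc a) b = trans (cong (x *_) (^ℚ-+ x a b)) (sym (QP.*-assoc x _ _))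

module _ {x : ℚ} (0≤x : 0ℚ Q.≤ x) where

  0≤^ℚ : ∀ k → 0ℚ Q.≤ x ^ℚ k
  0≤^ℚ zero = QP.nonNegative⁻¹ 1ℚ
  0≤^ℚ (suc k) = 0≤p*q 0≤x (0≤^ℚ k)

  ^ℚ≤1 : x Q.≤ 1ℚ → ∀ k → x ^ℚ k Q.≤ 1ℚ
  ^ℚ≤1 x≤1 zero = QP.≤-refl
  ^ℚ≤1 x≤1 (suc k) = *-≤1 0≤x x≤1 (^ℚ≤1 x≤1 k)

-- The union bound and its converse

module _ {q : ℚ} (0≤q : 0ℚ Q.≤ q) (q≤1 : q Q.≤ 1ℚ) where

  private
    0≤1-q : 0ℚ Q.≤ 1ℚ - q
    0≤1-q = 0≤q-p q≤1

    [1-q]^m≤1 : ∀ m → (1ℚ - q) ^ℚ m Q.≤ 1ℚ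
    [1-q]^m≤1 = ^ℚ≤1 0≤1-q (1-q≤1 0≤q)

  1-[1-q]^m≤m*q : ∀ m → 1ℚ - (1ℚ - q) ^ℚ m Q.≤ ℕ→ℚ m * q
  1-[1-q]^m≤m*q zero = QP.≤-reflexive (sym (QP.*-zeroˡ q))
  1-[1-q]^m≤m*q (suc m) = begin
    1ℚ - (1ℚ - q) * X         ≡⟨ expand q X ⟩
    (1ℚ - X) + q * X          ≤⟨ QP.+-mono-≤ (1-[1-q]^m≤m*q m) q*X≤q ⟩
    ℕ→ℚ m * q + q             ≡⟨ collect q (ℕ→ℚ m) ⟩
    (1ℚ + ℕ→ℚ m) * q          ≡⟨ cong (_* q) (ℕ→ℚ-suc m) ⟨
    ℕ→ℚ (suc m) * q           ∎
    where
    open QP.≤-Reasoning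
    X : ℚ
    X = (1ℚ - q) ^ℚ m
    q*X≤q : q * X Q.≤ q
    q*X≤q = subst₂ Q._≤_ refl (QP.*-identityʳ q) (*-monoˡ-≤-0≤ 0≤q ([1-q]^m≤1 m))
    expand : ∀ q X → 1ℚ - (1ℚ - q) * X ≡ (1ℚ - X) + q * X
    expand = solve-∀ ℚ-ring
    collect : ∀ q M → M * q + q ≡ (1ℚ + M) * q
    collect = solve-∀ ℚ-ring

  [1-q]^m*[1+m*q]≤1 : ∀ m → (1ℚ - q) ^ℚ m * (1ℚ + ℕ→ℚ m * q) Q.≤ 1ℚ
  [1-q]^m*[1+m*q]≤1 zero = QP.≤-reflexive (cong (1ℚ *_) (cong (1ℚ +_) (QP.*-zeroˡ q)))
  [1-q]^m*[1+m*q]≤1 (suc m) = begin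
    (1ℚ - q) * X * (1ℚ + ℕ→ℚ (suc m) * q)
      ≡⟨ cong (λ k → (1ℚ - q) * X * (1ℚ + k * q)) (ℕ→ℚ-suc m) ⟩
    (1ℚ - q) * X * (1ℚ + (1ℚ + M) * q)
      ≤⟨ p≤p+q (0≤p*q (0≤^ℚ 0≤1-q m) (0≤p*q (QP.+-mono-≤ (QP.nonNegative⁻¹ 1ℚ) (0≤ℕ→ℚ m)) (0≤p*q 0≤q 0≤q))) ⟩
    (1ℚ - q) * X * (1ℚ + (1ℚ + M) * q) + X * ((1ℚ + M) * (q * q))
      ≡⟨ expand q X M ⟩
    X * (1ℚ + M * q)
      ≤⟨ [1-q]^m*[1+m*q]≤1 m ⟩
    1ℚ ∎
    where
    open QP.≤-Reasoning
    X : ℚ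
    X = (1ℚ - q) ^ℚ m
    M : ℚ
    M = ℕ→ℚ m
    expand : ∀ q X M → (1ℚ - q) * X * (1ℚ + (1ℚ + M) * q) + X * ((1ℚ + M) * (q * q)) ≡ X * (1ℚ + M * q)
    expand = solve-∀ ℚ-ring

  m*q≤[1+m*P]*[1-[1-q]^m] : ∀ {P} → q Q.≤ P → ∀ m →
                            ℕ→ℚ m * q Q.≤ (1ℚ + ℕ→ℚ m * P) * (1ℚ - (1ℚ - q) ^ℚ m)
  m*q≤[1+m*P]*[1-[1-q]^m] {P} q≤P m = begin
    M * q                              ≤⟨ p≤p+q (0≤q-p ([1-q]^m*[1+m*q]≤1 m)) ⟩
    M * q + (1ℚ - X * (1ℚ + M * q))    ≡⟨ regroup q X M ⟩
    (1ℚ + M * q) * (1ℚ - X)            ≤⟨ *-monoʳ-≤-0≤ (0≤q-p ([1-q]^m≤1 m))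
                                            (QP.+-monoʳ-≤ 1ℚ (*-monoˡ-≤-0≤ (0≤ℕ→ℚ m) q≤P)) ⟩
    (1ℚ + M * P) * (1ℚ - X)            ∎
    where
    open QP.≤-Reasoning
    X : ℚ
    X = (1ℚ - q) ^ℚ m
    M : ℚ
    M = ℕ→ℚ m
    regroup : ∀ q X M → M * q + (1ℚ - X * (1ℚ + M * q)) ≡ (1ℚ + M * q) * (1ℚ - X)
    regroup = solve-∀ ℚ-ring

∑ : List A → (A → ℚ) → ℚ
∑ xs f = sumℚ (map f xs)

infix 5 ∑
syntax ∑ xs (λ x → e) = ∑[ x ← xs ] e

∑-cong : ∀ xs {f g : A → ℚ} → (∀ x → f x ≡ g x) → ∑ xs f ≡ ∑ xs g
∑-cong xs f≗g = cong sumℚ (map-cong f≗g xs)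

∑-mono : ∀ xs {f g : A → ℚ} → (∀ x → f x Q.≤ g x) → ∑ xs f Q.≤ ∑ xs g
∑-mono [] f≤g = QP.≤-refl
∑-mono (x ∷ xs) f≤g = QP.+-mono-≤ (f≤g x) (∑-mono xs f≤g)

∑-zero : (xs : List A) → ∑[ x ← xs ] 0ℚ ≡ 0ℚ
∑-zero [] = refl
∑-zero (x ∷ xs) = trans (QP.+-identityˡ _) (∑-zero xs)

∑-++ : ∀ xs ys (f : A → ℚ) → ∑ (xs ++ ys) f ≡ ∑ xs f + ∑ ys f
∑-++ [] ys f = sym (QP.+-identityˡ _)
∑-++ (x ∷ xs) ys f = trans (cong (f x +_) (∑-++ xs ys f)) (sym (QP.+-assoc (f x) _ _))

∑-map : ∀ (g : A → B) xs (f : B → ℚ) → ∑ (map g xs) f ≡ ∑ xs (f ∘ g)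
∑-map g xs f = cong sumℚ (sym (map-∘ xs))

∑-concatMap : ∀ (g : A → List B) xs (f : B → ℚ) → ∑ (concatMap g xs) f ≡ ∑[ x ← xs ] ∑ (g x) f
∑-concatMap g [] f = refl
∑-concatMap g (x ∷ xs) f = trans (∑-++ (g x) (concatMap g xs) f) (cong (∑ (g x) f +_) (∑-concatMap g xs f))

∑-+ : ∀ xs (f g : A → ℚ) → ∑[ x ← xs ] (f x + g x) ≡ ∑ xs f + ∑ xs g
∑-+ [] f g = refl
∑-+ (x ∷ xs) f g = trans (cong (f x + g x +_) (∑-+ xs f g)) (interchange (f x) (g x) (∑ xs f) (∑ xs g))
  where
  interchange : ∀ a b c d → a + b + (c + d) ≡ a + c + (b + d)
  interchange = solve-∀ ℚ-ring

∑-- : ∀ xs (f g : A → ℚ) → ∑[ x ← xs ] (f x - g x) ≡ ∑ xs f - ∑ xs g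
∑-- [] f g = refl
∑-- (x ∷ xs) f g = trans (cong (f x - g x +_) (∑-- xs f g)) (interchange (f x) (g x) (∑ xs f) (∑ xs g))
  where
  interchange : ∀ a b c d → a - b + (c - d) ≡ a + c - (b + d)
  interchange = solve-∀ ℚ-ring

∑-*ˡ : ∀ xs c (f : A → ℚ) → ∑[ x ← xs ] c * f x ≡ c * ∑ xs f
∑-*ˡ [] c f = sym (QP.*-zeroʳ c)
∑-*ˡ (x ∷ xs) c f = trans (cong (c * f x +_) (∑-*ˡ xs c f)) (sym (QP.*-distribˡ-+ c (f x) _))

∑-*ʳ : ∀ xs c (f : A → ℚ) → ∑[ x ← xs ] f x * c ≡ ∑ xs f * c
∑-*ʳ xs c f = trans (∑-cong xs (λ x → QP.*-comm (f x) c)) (trans (∑-*ˡ xs c f) (QP.*-comm c _))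

∑-swap : ∀ xs ys (f : A → B → ℚ) → ∑[ x ← xs ] ∑[ y ← ys ] f x y ≡ ∑[ y ← ys ] ∑[ x ← xs ] f x y
∑-swap [] ys f = sym (∑-zero ys)
∑-swap (x ∷ xs) ys f = trans (cong (∑ ys (f x) +_) (∑-swap xs ys f)) (sym (∑-+ ys (f x) _))

∑-factorˡ : ∀ xs c (f g : A → ℚ) → ∑[ x ← xs ] c * f x * g x ≡ c * (∑[ x ← xs ] f x * g x)
∑-factorˡ xs c f g = trans (∑-cong xs (λ x → QP.*-assoc c (f x) (g x))) (∑-*ˡ xs c _)

fromBool : Bool → ℚ
fromBool true = 1ℚ
fromBool false = 0ℚ

-- Defined through `does`, so that 𝟙 (any? P? (x ∷ xs)) reduces to 𝟙 (P? x ⊎-dec any? P? xs)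
-- and 𝟙 (suc m ≟ suc n) to 𝟙 (m ≟ n).
𝟙 : Dec P → ℚ
𝟙 P? = fromBool (does P?)

𝟙-yes : P → (P? : Dec P) → 𝟙 P? ≡ 1ℚ
𝟙-yes p P? = cong fromBool (dec-true P? p)

𝟙-no : ¬ P → (P? : Dec P) → 𝟙 P? ≡ 0ℚ
𝟙-no ¬p P? = cong fromBool (dec-false P? ¬p)

𝟙-×-dec : (P? : Dec P) (P′? : Dec P′) → 𝟙 (P? ×-dec P′?) ≡ 𝟙 P? * 𝟙 P′?
𝟙-×-dec (yes _) P′? = sym (QP.*-identityˡ (𝟙 P′?))
𝟙-×-dec (no _) P′? = sym (QP.*-zeroˡ (𝟙 P′?))

1-𝟙-⊎-dec : (P? : Dec P) (P′? : Dec P′) → 1ℚ - 𝟙 (P? ⊎-dec P′?) ≡ (1ℚ - 𝟙 P?) * (1ℚ - 𝟙 P′?)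
1-𝟙-⊎-dec (yes _) P′? = sym (QP.*-zeroˡ (1ℚ - 𝟙 P′?))
1-𝟙-⊎-dec (no _) P′? = sym (QP.*-identityˡ (1ℚ - 𝟙 P′?))

*𝟙-mono : ∀ {x y} → (P → x Q.≤ y) → (P? : Dec P) → x * 𝟙 P? Q.≤ y * 𝟙 P?
*𝟙-mono {x = x} {y} x≤y (yes p) = subst₂ Q._≤_ (sym (QP.*-identityʳ x)) (sym (QP.*-identityʳ y)) (x≤y p)
*𝟙-mono {x = x} {y} x≤y (no _) = QP.≤-reflexive (trans (QP.*-zeroʳ x) (sym (QP.*-zeroʳ y)))

*𝟙-≟ : ∀ {x y : A} (x≟y : Dec (x ≡ y)) (f : A → ℚ) → f x * 𝟙 x≟y ≡ f y * 𝟙 x≟y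
*𝟙-≟ (yes refl) f = refl
*𝟙-≟ {x = x} {y} (no _) f = trans (QP.*-zeroʳ (f x)) (sym (QP.*-zeroʳ (f y)))

ℕ→ℚ-length-filter : ∀ {P : A → Set} (P? : ∀ x → Dec (P x)) xs →
                    ℕ→ℚ (length (filter P? xs)) ≡ ∑[ x ← xs ] 𝟙 (P? x)
ℕ→ℚ-length-filter P? [] = refl
ℕ→ℚ-length-filter P? (x ∷ xs) with P? x
... | yes _ = trans (ℕ→ℚ-suc (length (filter P? xs))) (cong (1ℚ +_) (ℕ→ℚ-length-filter P? xs))
... | no _ = trans (ℕ→ℚ-length-filter P? xs) (sym (QP.+-identityˡ _))

module _ (_≟_ : DecidableEquality A) (f : A → ℚ) where

  ∑-*𝟙-∉ : ∀ {k xs} → k ∉ xs → ∑[ x ← xs ] f x * 𝟙 (k ≟ x) ≡ 0ℚ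
  ∑-*𝟙-∉ {k} {[]} _ = refl
  ∑-*𝟙-∉ {k} {x ∷ xs} k∉ =
    cong₂ _+_ (trans (cong (f x *_) (𝟙-no (k∉ ∘ Any.here) (k ≟ x))) (QP.*-zeroʳ (f x)))
              (∑-*𝟙-∉ (k∉ ∘ Any.there))

  ∑-*𝟙-∈ : ∀ {k xs} → Unique xs → k ∈ xs → ∑[ x ← xs ] f x * 𝟙 (k ≟ x) ≡ f k
  ∑-*𝟙-∈ {k} (x≢xs ∷ _) (Any.here refl) = begin
    f k * 𝟙 (k ≟ k) + _  ≡⟨ cong₂ _+_ (cong (f k *_) (𝟙-yes refl (k ≟ k)))
                                      (∑-*𝟙-∉ λ k∈ → All.lookup x≢xs k∈ refl) ⟩
    f k * 1ℚ + 0ℚ        ≡⟨ trans (QP.+-identityʳ _) (QP.*-identityʳ (f k)) ⟩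
    f k                  ∎
    where open ≡-Reasoning
  ∑-*𝟙-∈ {k} {x ∷ _} (x≢xs ∷ xs-unique) (Any.there k∈) = begin
    f x * 𝟙 (k ≟ x) + _  ≡⟨ cong₂ _+_ (cong (f x *_) (𝟙-no (λ k≡x → All.lookup x≢xs k∈ (sym k≡x)) (k ≟ x)))
                                      (∑-*𝟙-∈ xs-unique k∈) ⟩
    f x * 0ℚ + f k       ≡⟨ trans (cong (_+ f k) (QP.*-zeroʳ (f x))) (QP.+-identityˡ (f k)) ⟩
    f k                  ∎
    where open ≡-Reasoning

∈-range⁺ : ∀ {ℓ u i} → ℓ ℕ.≤ i → i ℕ.≤ u → i ∈ range ℓ u
∈-range⁺ {ℓ} {u} ℓ≤i i≤u =
  subst (_∈ range ℓ u) (ℕP.m+[n∸m]≡n ℓ≤i) (∈-map⁺ (ℓ ℕ.+_) (∈-upTo⁺ (ℕP.∸-monoˡ-< (ℕ.s≤s i≤u) ℓ≤i)))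

∈-range⁻ : ∀ {ℓ u i} → i ∈ range ℓ u → ℓ ℕ.≤ i × i ℕ.≤ u
∈-range⁻ {ℓ} {u} i∈ with ∈-map⁻ (ℓ ℕ.+_) i∈
... | j , j∈ , refl = ℕP.m≤m+n ℓ j , ℕP.≤-pred ℓ+j<1+u
  where
  j<1+u-ℓ : j ℕ.< suc u ℕ.∸ ℓ
  j<1+u-ℓ = ∈-upTo⁻ j∈
  ℓ<1+u : ℓ ℕ.< suc u
  ℓ<1+u = ℕP.m∸n≢0⇒n<m (λ 1+u-ℓ≡0 → ℕP.n≮0 (subst (j ℕ.<_) 1+u-ℓ≡0 j<1+u-ℓ))
  ℓ+j<1+u : ℓ ℕ.+ j ℕ.< suc u
  ℓ+j<1+u = subst (ℓ ℕ.+ j ℕ.<_) (ℕP.m+[n∸m]≡n (ℕP.<⇒≤ ℓ<1+u)) (ℕP.+-monoʳ-< ℓ j<1+u-ℓ)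

range-unique : ∀ ℓ u → Unique (range ℓ u)
range-unique ℓ u = Unique.map⁺ (ℕP.+-cancelˡ-≡ ℓ _ _) (Unique.upTo⁺ _)

∑-range-*𝟙 : ∀ ℓ u k c (ℓ≤k≤u? : Dec (ℓ ℕ.≤ k × k ℕ.≤ u)) →
             ∑[ i ← range ℓ u ] c * 𝟙 (k ℕ.≟ i) ≡ c * 𝟙 ℓ≤k≤u?
∑-range-*𝟙 ℓ u k c (yes (ℓ≤k , k≤u)) =
  trans (∑-*𝟙-∈ ℕ._≟_ (λ _ → c) (range-unique ℓ u) (∈-range⁺ ℓ≤k k≤u)) (sym (QP.*-identityʳ c))
∑-range-*𝟙 ℓ u k c (no k∉[ℓ,u]) =
  trans (∑-*𝟙-∉ ℕ._≟_ (λ _ → c) (k∉[ℓ,u] ∘ ∈-range⁻)) (sym (QP.*-zeroʳ c))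

allSubsets-unique : ∀ n → Unique (allSubsets n)
allSubsets-unique zero = All.[] ∷ []
allSubsets-unique (suc n) =
  Unique.++⁺ (Unique.map⁺ ∷-injectiveʳ unique) (Unique.map⁺ ∷-injectiveʳ unique) disjoint
  where
  unique : Unique (allSubsets n)
  unique = allSubsets-unique n
  disjoint : Disjoint (map (true ∷_) (allSubsets n)) (map (false ∷_) (allSubsets n))
  disjoint (∈true , ∈false) with ∈-map⁻ (true ∷_) ∈true | ∈-map⁻ (false ∷_) ∈false
  ... | _ , _ , refl | _ , _ , ()

∈-allSubsets : ∀ {n} (S : Subset n) → S ∈ allSubsets n
∈-allSubsets [] = Any.here refl
∈-allSubsets (true ∷ S) = ∈-++⁺ˡ (∈-map⁺ (true ∷_) (∈-allSubsets S))
∈-allSubsets (false ∷ S) = ∈-++⁺ʳ (map (true ∷_) _) (∈-map⁺ (false ∷_) (∈-allSubsets S))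

∑-allSubsets-suc : ∀ n (f : Subset (suc n) → ℚ) →
                   ∑ (allSubsets (suc n)) f ≡
                   (∑[ S ← allSubsets n ] f (true ∷ S)) + (∑[ S ← allSubsets n ] f (false ∷ S))
∑-allSubsets-suc n f =
  trans (∑-++ (map (true ∷_) L) _ f) (cong₂ _+_ (∑-map (true ∷_) L f) (∑-map (false ∷_) L f))
  where
    L : List (Subset n)
    L = allSubsets n

∑-𝟙-∣S∣≟ : ∀ n i → ∑[ S ← allSubsets n ] 𝟙 (∣ S ∣ ℕ.≟ i) ≡ ℕ→ℚ (n C i)
∑-𝟙-∣S∣≟ zero zero = refl
∑-𝟙-∣S∣≟ zero (suc i) = refl
∑-𝟙-∣S∣≟ (suc n) zero =
  trans (∑-allSubsets-suc n _) (trans (cong₂ _+_ (∑-zero (allSubsets n)) (∑-𝟙-∣S∣≟ n 0)) (QP.+-identityˡ _))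
∑-𝟙-∣S∣≟ (suc n) (suc i) = begin
  ∑[ S ← allSubsets (suc n) ] 𝟙 (∣ S ∣ ℕ.≟ suc i)  ≡⟨ ∑-allSubsets-suc n _ ⟩
  (∑[ S ← allSubsets n ] 𝟙 (∣ S ∣ ℕ.≟ i)) + (∑[ S ← allSubsets n ] 𝟙 (∣ S ∣ ℕ.≟ suc i))
                                                 ≡⟨ cong₂ _+_ (∑-𝟙-∣S∣≟ n i) (∑-𝟙-∣S∣≟ n (suc i)) ⟩
  ℕ→ℚ (n C i) + ℕ→ℚ (n C suc i)                   ≡⟨ ℕ→ℚ-+ (n C i) (n C suc i) ⟨
  ℕ→ℚ (n C i ℕ.+ n C suc i)                       ≡⟨ cong ℕ→ℚ (nCk+nC[k+1]≡[n+1]C[k+1] n i) ⟩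
  ℕ→ℚ (suc n C suc i)                             ∎
  where open ≡-Reasoning

-- The sample space

inRange? : ∀ {n} ℓ u (S : Subset n) → Dec (ℓ ℕ.≤ ∣ S ∣ × ∣ S ∣ ℕ.≤ u)
inRange? ℓ u S = (ℓ ≤? ∣ S ∣) ×-dec (∣ S ∣ ≤? u)

_≟ₛ_ : ∀ {n} → DecidableEquality (Subset n)
_≟ₛ_ = ≡-dec _≟ᵇ_

occurs? : ∀ {n m} (S : Subset n) (ω : Vec (Subset n) m) → Dec (S ∈ toList ω)
occurs? S ω = Any.any? (S ≟ₛ_) (toList ω)

module _ (p : ℚ) where

  setProb≡pointProb : ∀ {n} (S : Subset n) → setProb p S ≡ pointProb p n ∣ S ∣
  setProb≡pointProb [] = refl
  setProb≡pointProb (true ∷ S) = trans (cong (p *_) (setProb≡pointProb S)) (sym (QP.*-assoc p _ _))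
  setProb≡pointProb {suc n} (false ∷ S) = begin
    (1ℚ - p) * setProb p S
      ≡⟨ cong ((1ℚ - p) *_) (setProb≡pointProb S) ⟩
    (1ℚ - p) * (p ^ℚ k * (1ℚ - p) ^ℚ (n ℕ.∸ k))
      ≡⟨ swap (1ℚ - p) (p ^ℚ k) _ ⟩
    p ^ℚ k * (1ℚ - p) ^ℚ suc (n ℕ.∸ k)
      ≡⟨ cong (λ e → p ^ℚ k * (1ℚ - p) ^ℚ e) (ℕP.+-∸-assoc 1 (∣p∣≤n S)) ⟨
    p ^ℚ k * (1ℚ - p) ^ℚ (suc n ℕ.∸ k) ∎
    where
    open ≡-Reasoning
    k : ℕ
    k = ∣ S ∣
    swap : ∀ x y z → x * (y * z) ≡ y * (x * z)
    swap = solve-∀ ℚ-ring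

  ∑-setProb : ∀ n → ∑ (allSubsets n) (setProb p) ≡ 1ℚ
  ∑-setProb zero = refl
  ∑-setProb (suc n) = begin
    ∑ (allSubsets (suc n)) (setProb p)
      ≡⟨ ∑-allSubsets-suc n (setProb p) ⟩
    (∑[ S ← L ] p * setProb p S) + (∑[ S ← L ] (1ℚ - p) * setProb p S)
      ≡⟨ cong₂ _+_ (∑-*ˡ L p (setProb p)) (∑-*ˡ L (1ℚ - p) (setProb p)) ⟩
    p * ∑ L (setProb p) + (1ℚ - p) * ∑ L (setProb p)
      ≡⟨ cong (λ t → p * t + (1ℚ - p) * t) (∑-setProb n) ⟩
    p * 1ℚ + (1ℚ - p) * 1ℚ
      ≡⟨ total p ⟩
    1ℚ ∎
    where
    open ≡-Reasoning
    L : List (Subset n)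
    L = allSubsets n
    total : ∀ p → p * 1ℚ + (1ℚ - p) * 1ℚ ≡ 1ℚ
    total = solve-∀ ℚ-ring

  ∑-setProb-*[1-𝟙≟] : ∀ {n} (S : Subset n) →
                      ∑[ T ← allSubsets n ] setProb p T * (1ℚ - 𝟙 (S ≟ₛ T)) ≡ 1ℚ - setProb p S
  ∑-setProb-*[1-𝟙≟] {n} S = begin
    ∑[ T ← L ] setProb p T * (1ℚ - 𝟙 (S ≟ₛ T))
      ≡⟨ ∑-cong L (λ T → distrib (setProb p T) (𝟙 (S ≟ₛ T))) ⟩
    ∑[ T ← L ] (setProb p T - setProb p T * 𝟙 (S ≟ₛ T))
      ≡⟨ ∑-- L (setProb p) (λ T → setProb p T * 𝟙 (S ≟ₛ T)) ⟩
    ∑ L (setProb p) - (∑[ T ← L ] setProb p T * 𝟙 (S ≟ₛ T))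
      ≡⟨ cong₂ _-_ (∑-setProb n) (∑-*𝟙-∈ _≟ₛ_ (setProb p) (allSubsets-unique n) (∈-allSubsets S)) ⟩
    1ℚ - setProb p S ∎
    where
    open ≡-Reasoning
    L : List (Subset n)
    L = allSubsets n
    distrib : ∀ x y → x * (1ℚ - y) ≡ x - x * y
    distrib = solve-∀ ℚ-ring

  𝔼 : ∀ {n} m → (Vec (Subset n) m → ℚ) → ℚ
  𝔼 {n} m f = ∑[ ω ← allSamples n m ] sampleProb p ω * f ω

  module _ {n : ℕ} where

    𝔼-cong : ∀ m {f g : Vec (Subset n) m → ℚ} → (∀ ω → f ω ≡ g ω) → 𝔼 m f ≡ 𝔼 m g
    𝔼-cong m f≗g = ∑-cong (allSamples n m) (λ ω → cong (sampleProb p ω *_) (f≗g ω))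

    𝔼-- : ∀ m (f g : Vec (Subset n) m → ℚ) → 𝔼 m (λ ω → f ω - g ω) ≡ 𝔼 m f - 𝔼 m g
    𝔼-- m f g = trans (∑-cong Ω (λ ω → distrib (sampleProb p ω) (f ω) (g ω))) (∑-- Ω _ _)
      where
      Ω : List (Vec (Subset n) m)
      Ω = allSamples n m
      distrib : ∀ x y z → x * (y - z) ≡ x * y - x * z
      distrib = solve-∀ ℚ-ring

    𝔼-*ʳ : ∀ m (f : Vec (Subset n) m → ℚ) c → 𝔼 m (λ ω → f ω * c) ≡ 𝔼 m f * c
    𝔼-*ʳ m f c = trans (∑-cong Ω (λ ω → sym (QP.*-assoc (sampleProb p ω) (f ω) c))) (∑-*ʳ Ω c _)
      where
        Ω : List (Vec (Subset n) m)
        Ω = allSamples n m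

    𝔼-∑ : ∀ m (xs : List A) (F : A → Vec (Subset n) m → ℚ) →
          𝔼 m (λ ω → ∑[ x ← xs ] F x ω) ≡ ∑[ x ← xs ] 𝔼 m (F x)
    𝔼-∑ m xs F = trans (∑-cong Ω (λ ω → sym (∑-*ˡ xs (sampleProb p ω) (λ x → F x ω)))) (∑-swap Ω xs _)
      where
        Ω : List (Vec (Subset n) m)
        Ω = allSamples n m

    𝔼-∷ : ∀ m (g : Subset n → ℚ) (h : Vec (Subset n) m → ℚ) →
          𝔼 (suc m) (λ ω → g (head ω) * h (tail ω)) ≡ (∑[ T ← allSubsets n ] setProb p T * g T) * 𝔼 m h
    𝔼-∷ m g h = begin
      𝔼 (suc m) (λ ω → g (head ω) * h (tail ω))
        ≡⟨ ∑-concatMap (λ T → map (T ∷_) Ω) L _ ⟩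
      ∑[ T ← L ] ∑[ ω ← map (T ∷_) Ω ] sampleProb p ω * (g (head ω) * h (tail ω))
        ≡⟨ ∑-cong L (λ T → trans (∑-map (T ∷_) Ω _) (factor T)) ⟩
      ∑[ T ← L ] setProb p T * g T * 𝔼 m h
        ≡⟨ ∑-*ʳ L (𝔼 m h) _ ⟩
      (∑[ T ← L ] setProb p T * g T) * 𝔼 m h ∎
      where
      open ≡-Reasoning
      L : List (Subset n)
      L = allSubsets n
      Ω : List (Vec (Subset n) m)
      Ω = allSamples n m
      regroup : ∀ a b c d → a * b * (c * d) ≡ a * c * (b * d)
      regroup = solve-∀ ℚ-ring
      factor : ∀ T → ∑[ ω ← Ω ] setProb p T * sampleProb p ω * (g T * h ω) ≡ setProb p T * g T * 𝔼 m h
      factor T = trans (∑-cong Ω (λ ω → regroup (setProb p T) (sampleProb p ω) (g T) (h ω)))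
                       (∑-*ˡ Ω (setProb p T * g T) _)

    𝔼-1 : ∀ m → 𝔼 m (λ _ → 1ℚ) ≡ 1ℚ
    𝔼-1 zero = refl
    𝔼-1 (suc m) = trans (𝔼-∷ m (λ _ → 1ℚ) (λ _ → 1ℚ))
      (cong₂ _*_ (trans (∑-cong (allSubsets n) (λ T → QP.*-identityʳ (setProb p T))) (∑-setProb n)) (𝔼-1 m))

    𝔼-miss : ∀ m (S : Subset n) → 𝔼 m (λ ω → 1ℚ - 𝟙 (occurs? S ω)) ≡ (1ℚ - setProb p S) ^ℚ m
    𝔼-miss zero S = refl
    𝔼-miss (suc m) S = begin
      𝔼 (suc m) (λ ω → 1ℚ - 𝟙 (occurs? S ω))
        ≡⟨ 𝔼-cong (suc m) (λ { (T ∷ ω) → 1-𝟙-⊎-dec (S ≟ₛ T) (occurs? S ω) }) ⟩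
      𝔼 (suc m) (λ ω → (1ℚ - 𝟙 (S ≟ₛ head ω)) * (1ℚ - 𝟙 (occurs? S (tail ω))))
        ≡⟨ 𝔼-∷ m _ _ ⟩
      (∑[ T ← allSubsets n ] setProb p T * (1ℚ - 𝟙 (S ≟ₛ T))) * 𝔼 m (λ ω → 1ℚ - 𝟙 (occurs? S ω))
        ≡⟨ cong₂ _*_ (∑-setProb-*[1-𝟙≟] S) (𝔼-miss m S) ⟩
      (1ℚ - setProb p S) * (1ℚ - setProb p S) ^ℚ m ∎
      where open ≡-Reasoning

    hitProb : ∀ m → Subset n → ℚ
    hitProb m S = 𝔼 m (λ ω → 𝟙 (occurs? S ω))

    hitProb≡ : ∀ m S → hitProb m S ≡ 1ℚ - (1ℚ - setProb p S) ^ℚ m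
    hitProb≡ m S = begin
      𝔼 m (λ ω → 𝟙 (occurs? S ω))                         ≡⟨ 𝔼-cong m (λ ω → sym (1-[1-x] (𝟙 (occurs? S ω)))) ⟩
      𝔼 m (λ ω → 1ℚ - (1ℚ - 𝟙 (occurs? S ω)))             ≡⟨ 𝔼-- m _ _ ⟩
      𝔼 m (λ _ → 1ℚ) - 𝔼 m (λ ω → 1ℚ - 𝟙 (occurs? S ω))   ≡⟨ cong₂ _-_ (𝔼-1 m) (𝔼-miss m S) ⟩
      1ℚ - (1ℚ - setProb p S) ^ℚ m                         ∎
      where
      open ≡-Reasoning
      1-[1-x] : ∀ x → 1ℚ - (1ℚ - x) ≡ x
      1-[1-x] = solve-∀ ℚ-ring

  expectedDistinct≡ : ∀ n m ℓ u →
    expectedDistinct p n m ℓ u ≡ ∑[ S ← allSubsets n ] hitProb m S * 𝟙 (inRange? ℓ u S)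
  expectedDistinct≡ n m ℓ u = begin
    𝔼 m (λ ω → ℕ→ℚ (distinctInRange ℓ u ω))
      ≡⟨ 𝔼-cong m (λ ω → trans (ℕ→ℚ-length-filter _ L) (∑-cong L (λ S → split S ω))) ⟩
    𝔼 m (λ ω → ∑[ S ← L ] 𝟙 (occurs? S ω) * 𝟙 (inRange? ℓ u S))
      ≡⟨ 𝔼-∑ m L _ ⟩
    ∑[ S ← L ] 𝔼 m (λ ω → 𝟙 (occurs? S ω) * 𝟙 (inRange? ℓ u S))
      ≡⟨ ∑-cong L (λ S → 𝔼-*ʳ m _ _) ⟩
    ∑[ S ← L ] hitProb m S * 𝟙 (inRange? ℓ u S) ∎
    where
    open ≡-Reasoning
    L : List (Subset n)
    L = allSubsets n
    split : ∀ S ω → 𝟙 (inRange? ℓ u S ×-dec occurs? S ω) ≡ 𝟙 (occurs? S ω) * 𝟙 (inRange? ℓ u S)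
    split S ω = trans (𝟙-×-dec (inRange? ℓ u S) (occurs? S ω)) (QP.*-comm (𝟙 (inRange? ℓ u S)) _)

  binProbRange≡ : ∀ n ℓ u →
    binProbRange p n ℓ u ≡ ∑[ S ← allSubsets n ] setProb p S * 𝟙 (inRange? ℓ u S)
  binProbRange≡ n ℓ u = begin
    ∑[ i ← R ] ℕ→ℚ (n C i) * pointProb p n i
      ≡⟨ ∑-cong R (λ i → cong (_* pointProb p n i) (∑-𝟙-∣S∣≟ n i)) ⟨
    ∑[ i ← R ] (∑[ S ← L ] 𝟙 (∣ S ∣ ℕ.≟ i)) * pointProb p n i
      ≡⟨ ∑-cong R (λ i → ∑-*ʳ L (pointProb p n i) _) ⟨
    ∑[ i ← R ] ∑[ S ← L ] 𝟙 (∣ S ∣ ℕ.≟ i) * pointProb p n i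
      ≡⟨ ∑-cong R (λ i → ∑-cong L (λ S → sizeIndicator S i)) ⟩
    ∑[ i ← R ] ∑[ S ← L ] setProb p S * 𝟙 (∣ S ∣ ℕ.≟ i)
      ≡⟨ ∑-swap R L _ ⟩
    ∑[ S ← L ] ∑[ i ← R ] setProb p S * 𝟙 (∣ S ∣ ℕ.≟ i)
      ≡⟨ ∑-cong L (λ S → ∑-range-*𝟙 ℓ u ∣ S ∣ (setProb p S) (inRange? ℓ u S)) ⟩
    ∑[ S ← L ] setProb p S * 𝟙 (inRange? ℓ u S) ∎
    where
    open ≡-Reasoning
    R : List ℕ
    R = range ℓ u
    L : List (Subset n)
    L = allSubsets n
    sizeIndicator : ∀ S i → 𝟙 (∣ S ∣ ℕ.≟ i) * pointProb p n i ≡ setProb p S * 𝟙 (∣ S ∣ ℕ.≟ i)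
    sizeIndicator S i = begin
      𝟙 (∣ S ∣ ℕ.≟ i) * pointProb p n i      ≡⟨ QP.*-comm (𝟙 (∣ S ∣ ℕ.≟ i)) _ ⟩
      pointProb p n i * 𝟙 (∣ S ∣ ℕ.≟ i)      ≡⟨ *𝟙-≟ (∣ S ∣ ℕ.≟ i) (pointProb p n) ⟨
      pointProb p n ∣ S ∣ * 𝟙 (∣ S ∣ ℕ.≟ i)  ≡⟨ cong (_* 𝟙 (∣ S ∣ ℕ.≟ i)) (setProb≡pointProb S) ⟨
      setProb p S * 𝟙 (∣ S ∣ ℕ.≟ i)          ∎

-- The maximum 𝐩

-- Uses that 1ℚ - ½ computes to ½; so does the case p ≡ ½ of lemma17.
pointProb-½ : ∀ {n i} → i ℕ.≤ n → pointProb ½ n i ≡ ½ ^ℚ n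
pointProb-½ {n} {i} i≤n = trans (sym (^ℚ-+ ½ i (n ℕ.∸ i))) (cong (½ ^ℚ_) (ℕP.m+[n∸m]≡n i≤n))

module _ {p : ℚ} {n ℓ u : ℕ} where

  pointProb≤boldP : ∀ {i} → ℓ ℕ.≤ i → i ℕ.≤ u → pointProb p n i Q.≤ boldP p n ℓ u
  pointProb≤boldP ℓ≤i i≤u = foldr-preservesᵒ ≤⊔ (pointProb p n ℓ) (map (pointProb p n) (range ℓ u))
    (inj₂ (Any.map⁺ (Any.map (λ { refl → QP.≤-refl }) (∈-range⁺ ℓ≤i i≤u))))
    where
    ≤⊔ : ∀ x y → _ Q.≤ x ⊎ _ Q.≤ y → _ Q.≤ x ⊔ y
    ≤⊔ x y (inj₁ ≤x) = QP.p≤q⇒p≤q⊔r y ≤x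
    ≤⊔ x y (inj₂ ≤y) = QP.p≤q⇒p≤r⊔q x ≤y

  boldP-lub : ∀ {b} → ℓ ℕ.≤ u → (∀ {i} → ℓ ℕ.≤ i → i ℕ.≤ u → pointProb p n i Q.≤ b) → boldP p n ℓ u Q.≤ b
  boldP-lub {b} ℓ≤u ≤b = foldr-preservesᵇ {P = Q._≤ b} QP.⊔-lub (≤b ℕP.≤-refl ℓ≤u)
    (All.map⁺ (All.tabulate (λ i∈ → let ℓ≤i , i≤u = ∈-range⁻ i∈ in ≤b ℓ≤i i≤u)))

  boldP-attained : ∀ {i} → ℓ ℕ.≤ i → i ℕ.≤ u →
                   (∀ {j} → ℓ ℕ.≤ j → j ℕ.≤ u → pointProb p n j Q.≤ pointProb p n i) →
                   boldP p n ℓ u ≡ pointProb p n i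
  boldP-attained ℓ≤i i≤u max = QP.≤-antisym (boldP-lub (ℕP.≤-trans ℓ≤i i≤u) max) (pointProb≤boldP ℓ≤i i≤u)

module _ {a r} {X : Set a} {_R_ : Rel X r} (R-refl : Reflexive _R_) (R-trans : Transitive _R_)
         (f : ℕ → X) {n : ℕ} (step : ∀ {i} → suc i ℕ.≤ n → f i R f (suc i)) where

  stepwise⇒monotone : ∀ {i j} → i ℕ.≤ j → j ℕ.≤ n → f i R f j
  stepwise⇒monotone i≤j = go (ℕP.≤⇒≤′ i≤j)
    where
    go : ∀ {i j} → i ≤′ j → j ℕ.≤ n → f i R f j
    go ≤′-refl _ = R-refl
    go (≤′-step i≤′j) j<n = R-trans (go i≤′j (ℕP.<⇒≤ j<n)) (step j<n)

module _ {p : ℚ} (0≤p : 0ℚ Q.≤ p) (p≤1 : p Q.≤ 1ℚ) where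

  pointProb-consecutive : ∀ {n i} → suc i ℕ.≤ n →
    ∃[ w ] 0ℚ Q.≤ w × pointProb p n (suc i) ≡ p * w × pointProb p n i ≡ (1ℚ - p) * w
  pointProb-consecutive {n} {i} i<n =
    w , 0≤p*q (0≤^ℚ 0≤p i) (0≤^ℚ (0≤q-p p≤1) (n ℕ.∸ suc i)) , QP.*-assoc p _ _ , split
    where
    w = p ^ℚ i * (1ℚ - p) ^ℚ (n ℕ.∸ suc i)
    swap : ∀ x y z → x * (y * z) ≡ y * (x * z)
    swap = solve-∀ ℚ-ring
    split : pointProb p n i ≡ (1ℚ - p) * w
    split = trans (cong (λ e → p ^ℚ i * (1ℚ - p) ^ℚ e) (ℕP.+-∸-assoc 1 {n} {suc i} i<n))
                  (swap (p ^ℚ i) (1ℚ - p) _)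

  pointProb-antitone : p Q.≤ 1ℚ - p → ∀ {n i j} → i ℕ.≤ j → j ℕ.≤ n → pointProb p n j Q.≤ pointProb p n i
  pointProb-antitone p≤1-p {n} =
    stepwise⇒monotone {_R_ = flip Q._≤_} QP.≤-refl (flip QP.≤-trans) (pointProb p n) step
    where
    step : ∀ {i} → suc i ℕ.≤ n → pointProb p n (suc i) Q.≤ pointProb p n i
    step i<n = let w , 0≤w , pw , [1-p]w = pointProb-consecutive i<n in
      subst₂ Q._≤_ (sym pw) (sym [1-p]w) (*-monoʳ-≤-0≤ 0≤w p≤1-p)

  pointProb-monotone : 1ℚ - p Q.≤ p → ∀ {n i j} → i ℕ.≤ j → j ℕ.≤ n → pointProb p n i Q.≤ pointProb p n j
  pointProb-monotone 1-p≤p {n} =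
    stepwise⇒monotone {_R_ = Q._≤_} QP.≤-refl QP.≤-trans (pointProb p n) step
    where
    step : ∀ {i} → suc i ℕ.≤ n → pointProb p n i Q.≤ pointProb p n (suc i)
    step i<n = let w , 0≤w , pw , [1-p]w = pointProb-consecutive i<n in
      subst₂ Q._≤_ (sym [1-p]w) (sym pw) (*-monoʳ-≤-0≤ 0≤w 1-p≤p)

  module _ {n ℓ u : ℕ} (ℓ≤u : ℓ ℕ.≤ u) (u≤n : u ℕ.≤ n) where

    boldP≡pointProb-ℓ : p Q.≤ 1ℚ - p → boldP p n ℓ u ≡ pointProb p n ℓ
    boldP≡pointProb-ℓ p≤1-p = boldP-attained ℕP.≤-refl ℓ≤u
      (λ ℓ≤j j≤u → pointProb-antitone p≤1-p ℓ≤j (ℕP.≤-trans j≤u u≤n))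

    boldP≡pointProb-u : 1ℚ - p Q.≤ p → boldP p n ℓ u ≡ pointProb p n u
    boldP≡pointProb-u 1-p≤p = boldP-attained ℓ≤u ℕP.≤-refl
      (λ _ j≤u → pointProb-monotone 1-p≤p j≤u u≤n)

-- Bounds on the expected count

module _ {p : ℚ} (0≤p : 0ℚ Q.≤ p) (p≤1 : p Q.≤ 1ℚ) where

  0≤setProb : ∀ {n} (S : Subset n) → 0ℚ Q.≤ setProb p S
  0≤setProb [] = QP.nonNegative⁻¹ 1ℚ
  0≤setProb (true ∷ S) = 0≤p*q 0≤p (0≤setProb S)
  0≤setProb (false ∷ S) = 0≤p*q (0≤q-p p≤1) (0≤setProb S)

  setProb≤1 : ∀ {n} (S : Subset n) → setProb p S Q.≤ 1ℚ
  setProb≤1 [] = QP.≤-refl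
  setProb≤1 (true ∷ S) = *-≤1 0≤p p≤1 (setProb≤1 S)
  setProb≤1 (false ∷ S) = *-≤1 (0≤q-p p≤1) (1-q≤1 0≤p) (setProb≤1 S)

  module _ {n : ℕ} (m : ℕ) (S : Subset n) where

    hitProb≤m*setProb : hitProb p m S Q.≤ ℕ→ℚ m * setProb p S
    hitProb≤m*setProb = subst₂ Q._≤_ (sym (hitProb≡ p m S)) refl
      (1-[1-q]^m≤m*q (0≤setProb S) (setProb≤1 S) m)

    m*setProb≤[1+m*P]*hitProb : ∀ {P} → setProb p S Q.≤ P →
                                ℕ→ℚ m * setProb p S Q.≤ (1ℚ + ℕ→ℚ m * P) * hitProb p m S
    m*setProb≤[1+m*P]*hitProb {P} q≤P = subst₂ Q._≤_ refl (cong ((1ℚ + ℕ→ℚ m * P) *_) (sym (hitProb≡ p m S)))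
      (m*q≤[1+m*P]*[1-[1-q]^m] (0≤setProb S) (setProb≤1 S) q≤P m)

  module _ (n m ℓ u : ℕ) where

    private
      L : List (Subset n)
      L = allSubsets n
      M : ℚ
      M = ℕ→ℚ m
      𝐩 : ℚ
      𝐩 = boldP p n ℓ u

    expectedDistinct≤m*binProbRange : expectedDistinct p n m ℓ u Q.≤ M * binProbRange p n ℓ u
    expectedDistinct≤m*binProbRange = begin
      expectedDistinct p n m ℓ u                        ≡⟨ expectedDistinct≡ p n m ℓ u ⟩
      ∑[ S ← L ] hitProb p m S * 𝟙 (inRange? ℓ u S)     ≤⟨ ∑-mono L (λ S → *𝟙-mono (λ _ → union S) (inRange? ℓ u S)) ⟩
      ∑[ S ← L ] M * setProb p S * 𝟙 (inRange? ℓ u S)   ≡⟨ ∑-factorˡ L M (setProb p) _ ⟩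
      M * (∑[ S ← L ] setProb p S * 𝟙 (inRange? ℓ u S)) ≡⟨ cong (M *_) (binProbRange≡ p n ℓ u) ⟨
      M * binProbRange p n ℓ u                          ∎
      where
      open QP.≤-Reasoning
      union : ∀ S → hitProb p m S Q.≤ M * setProb p S
      union = hitProb≤m*setProb m

    m*binProbRange≤[1+m*boldP]*expectedDistinct :
      M * binProbRange p n ℓ u Q.≤ (1ℚ + M * 𝐩) * expectedDistinct p n m ℓ u
    m*binProbRange≤[1+m*boldP]*expectedDistinct = begin
      M * binProbRange p n ℓ u                          ≡⟨ cong (M *_) (binProbRange≡ p n ℓ u) ⟩
      M * (∑[ S ← L ] setProb p S * 𝟙 (inRange? ℓ u S)) ≡⟨ ∑-factorˡ L M (setProb p) _ ⟨
      ∑[ S ← L ] M * setProb p S * 𝟙 (inRange? ℓ u S)   ≤⟨ ∑-mono L (λ S → *𝟙-mono (termwise S) (inRange? ℓ u S)) ⟩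
      ∑[ S ← L ] (1ℚ + M * 𝐩) * hitProb p m S * 𝟙 (inRange? ℓ u S)
                                                 ≡⟨ ∑-factorˡ L (1ℚ + M * 𝐩) (hitProb p m) _ ⟩
      (1ℚ + M * 𝐩) * (∑[ S ← L ] hitProb p m S * 𝟙 (inRange? ℓ u S))
                                                 ≡⟨ cong ((1ℚ + M * 𝐩) *_) (expectedDistinct≡ p n m ℓ u) ⟨
      (1ℚ + M * 𝐩) * expectedDistinct p n m ℓ u         ∎
      where
      open QP.≤-Reasoning
      termwise : ∀ S → ℓ ℕ.≤ ∣ S ∣ × ∣ S ∣ ℕ.≤ u → M * setProb p S Q.≤ (1ℚ + M * 𝐩) * hitProb p m S
      termwise S (ℓ≤∣S∣ , ∣S∣≤u) = m*setProb≤[1+m*P]*hitProb m S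
        (subst (Q._≤ 𝐩) (sym (setProb≡pointProb p S)) (pointProb≤boldP ℓ≤∣S∣ ∣S∣≤u))

lemma17 : (p : ℚ) → 0ℚ Q.< p → p Q.< 1ℚ →
          (n m ℓ u : ℕ) → 1 ≤ n → 1 ≤ m → ℓ ≤ u → u ≤ n →
          ((p Q.< ½ → boldP p n ℓ u ≡ pointProb p n ℓ)
          × (p ≡ ½ → boldP p n ℓ u ≡ ½ ^ℚ n)
          × (½ Q.< p → boldP p n ℓ u ≡ pointProb p n u))
          × (ℕ→ℚ m * binProbRange p n ℓ u Q.≤ (1ℚ + ℕ→ℚ m * boldP p n ℓ u) * expectedDistinct p n m ℓ u)
          × (expectedDistinct p n m ℓ u Q.≤ ℕ→ℚ m * binProbRange p n ℓ u)
lemma17 p 0<p p<1 n m ℓ u _ _ ℓ≤u u≤n =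
  ( (λ p<½ → boldP≡pointProb-ℓ 0≤p p≤1 ℓ≤u u≤n (p≤½⇒p≤1-p (QP.<⇒≤ p<½)))
  , (λ { refl → trans (boldP≡pointProb-ℓ 0≤p p≤1 ℓ≤u u≤n QP.≤-refl) (pointProb-½ (ℕP.≤-trans ℓ≤u u≤n)) })
  , (λ ½<p → boldP≡pointProb-u 0≤p p≤1 ℓ≤u u≤n (½≤p⇒1-p≤p (QP.<⇒≤ ½<p))) )
  , m*binProbRange≤[1+m*boldP]*expectedDistinct 0≤p p≤1 n m ℓ u
  , expectedDistinct≤m*binProbRange 0≤p p≤1 n m ℓ u
  where
  0≤p : 0ℚ Q.≤ p
  0≤p = QP.<⇒≤ 0<p
  p≤1 : p Q.≤ 1ℚ
  p≤1 = QP.<⇒≤ p<1
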